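{- For each integer $i>1$, there exists a graph $X_i$ with exactly $2^i-2$ vertices that contains no clique of size $i$, but such that every $i$-vertex graph other than the complete graph $K_i$ is isomorphic to an induced subgraph of $X_i$.
   Context: All graphs are finite, simple and undirected. -}

module Defs where

open import Data.Nat using (ℕ)
open import Data.Fin using (Fin)
open import Data.Bool using (Bool; true; false)
open import Data.Product using (Σ; _×_)
open import Relation.Binary.PropositionalEquality using (_≡_; _≢_)
open import Relation.Nullary using (¬_)
open import Function.Definitions using (Injective)

record Graph (n : ℕ) : Set where
  field
    adj   : Fin n → Fin n → Bool
    sym   : ∀ u v → adj u v ≡ adj v u
    irrefl : ∀ v → adj v v ≡ false
open Graph public

IsComplete : ∀ {n} → Graph n → Set
IsComplete G = ∀ u v → u ≢ v → adj G u v ≡ true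

HasClique : ∀ {n} → ℕ → Graph n → Set
HasClique {n} k G =
  Σ (Fin k → Fin n) λ f → Injective _≡_ _≡_ f ×
    (∀ a b → a ≢ b → adj G (f a) (f b) ≡ true)

InducedSub : ∀ {m n} → Graph m → Graph n → Set
InducedSub {m} {n} H G =
  Σ (Fin m → Fin n) λ f → Injective _≡_ _≡_ f ×
    (∀ a b → adj G (f a) (f b) ≡ adj H a b)

{-# OPTIONS --safe #-}
module Submission where

-- For i = n + 1, take one vertex for every bit string of length l + 1 and every level
-- l < n, which gives 2 + 4 + ⋯ + 2ⁿ = 2ⁱ − 2 vertices.  Vertices of equal level are never
-- adjacent, and a vertex of level l is adjacent to one of higher level iff the latter's
-- string has a 1 in position l + 1.  The levels colour the graph with n colours, so it has
-- no Kᵢ.  A graph G on i vertices that is not complete has non-adjacent u ≠ v; put u and v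
-- on level n − 1 and the remaining vertices on the levels 0, …, n − 2, one each, and send a
-- vertex to the string whose bit 0 tells u from v and whose bit l + 1 records its
-- adjacency to the vertex of level l.

open import Defs hiding (sym)
open import Data.Bool using (Bool; true; false; _∨_)
open import Data.Bool.Properties using (∨-comm; ∨-identityʳ; ¬-not) renaming (_≟_ to _≟ᵇ_)
open import Data.Empty using (⊥; ⊥-elim)
open import Data.Fin using (Fin; toℕ; fromℕ<; punchIn; punchOut; finToFun; funToFin)
open import Data.Fin.Properties
  using (0↔⊥; 2↔Bool; +↔⊎; toℕ<n; toℕ-fromℕ<; fromℕ<-injective; fromℕ<-toℕ;
         punchIn-punchOut; punchOut-injective; finToFun-funToFin;
         pigeonhole; ¬∀⟶∃¬; all?)
  renaming (_≟_ to _≟ᶠ_; <⇒≢ to <⇒≢ᶠ)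
open import Data.Nat using (ℕ; zero; suc; _+_; _<_; _≤_; _^_; _∸_; z≤n; s≤s; s≤s⁻¹; _<?_; _≟_)
open import Data.Nat.Properties
  using (+-identityʳ; +-∸-comm; ^-monoʳ-≤; ≤∧≢⇒<; m<n⇒m<1+n; n<1+n; <-irrefl; <-≤-trans;
         ≤-reflexive; <-cmp)
open import Data.Product using (Σ; _×_; _,_; ∃₂)
open import Data.Sum using (_⊎_; inj₁; inj₂)
open import Data.Sum.Function.Propositional using (_⊎-↔_)
open import Function using (_∘_)
open import Function.Bundles using (_↔_; Inverse)
open import Function.Definitions using (Injective)
open import Function.Properties.Inverse using (↔-refl; ↔-trans)
open import Relation.Binary.Definitions using (tri<; tri≈; tri>)
open import Relation.Binary.PropositionalEquality
open import Relation.Nullary using (¬_; yes; no; does)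
open import Relation.Nullary.Decidable using (_→-dec_; ¬?; dec-true; dec-false)

colourable⇒¬HasClique : ∀ {k n} (G : Graph k) (c : Fin k → Fin n) →
  (∀ a b → c a ≡ c b → adj G a b ≡ false) → ¬ HasClique (suc n) G
colourable⇒¬HasClique {n = n} G c proper (f , _ , clique)
  with pigeonhole (n<1+n n) (c ∘ f)
... | i , j , i<j , same with trans (sym (clique i j (<⇒≢ᶠ i<j))) (proper (f i) (f j) same)
... | ()

-- Bit strings of length k, coded as Fin (2 ^ k).  Positions j ≥ k read as false.
bit : ∀ k → Fin (2 ^ k) → ℕ → Bool
bit k s j with j <? k
... | yes j<k = Inverse.to 2↔Bool (finToFun {2} {k} s (fromℕ< j<k))
... | no _    = false

encode : ∀ k → (ℕ → Bool) → Fin (2 ^ k)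
encode k f = funToFin {k} {2} (λ i → Inverse.from 2↔Bool (f (toℕ i)))

bit-encode : ∀ k f {j} → j < k → bit k (encode k f) j ≡ f j
bit-encode k f {j} j<k with j <? k
... | no j≮k  = ⊥-elim (j≮k j<k)
... | yes j<k′ = begin
  Inverse.to 2↔Bool (finToFun {2} {k} (encode k f) (fromℕ< j<k′))
    ≡⟨ cong (Inverse.to 2↔Bool) (finToFun-funToFin {k} {2} _ (fromℕ< j<k′)) ⟩
  Inverse.to 2↔Bool (Inverse.from 2↔Bool (f (toℕ (fromℕ< j<k′))))
    ≡⟨ Inverse.strictlyInverseˡ 2↔Bool _ ⟩
  f (toℕ (fromℕ< j<k′))
    ≡⟨ cong f (toℕ-fromℕ< j<k′) ⟩
  f j ∎
  where open ≡-Reasoning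

bit-≥ : ∀ k (s : Fin (2 ^ k)) {j} → k ≤ j → bit k s j ≡ false
bit-≥ k s {j} k≤j with j <? k
... | yes j<k = ⊥-elim (<-irrefl refl (<-≤-trans j<k k≤j))
... | no _    = refl

Vertex : ℕ → Set
Vertex zero    = ⊥
Vertex (suc n) = Vertex n ⊎ Fin (2 ^ suc n)

level : ∀ {n} → Vertex n → ℕ
level {suc n} (inj₁ x) = level x
level {suc n} (inj₂ _) = n

level< : ∀ {n} (x : Vertex n) → level x < n
level< {suc n} (inj₁ x) = m<n⇒m<1+n (level< x)
level< {suc n} (inj₂ _) = n<1+n n

label : ∀ {n} → Vertex n → ℕ → Bool
label {suc n} (inj₁ x) = label x
label {suc n} (inj₂ s) = bit (suc n) s

label-beyond : ∀ {n} (x : Vertex n) {j} → level x < j → label x j ≡ false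
label-beyond {suc n} (inj₁ x) lt = label-beyond x lt
label-beyond {suc n} (inj₂ s) lt = bit-≥ (suc n) s lt

vertex : ∀ {n} l → l < n → (ℕ → Bool) → Vertex n
vertex {suc n} l l<1+n f with l ≟ n
... | yes _   = inj₂ (encode (suc n) f)
... | no l≢n = inj₁ (vertex l (≤∧≢⇒< (s≤s⁻¹ l<1+n) l≢n) f)

level-vertex : ∀ {n} l (l<n : l < n) f → level (vertex l l<n f) ≡ l
level-vertex {suc n} l l<1+n f with l ≟ n
... | yes l≡n = sym l≡n
... | no l≢n  = level-vertex l (≤∧≢⇒< (s≤s⁻¹ l<1+n) l≢n) f

label-vertex : ∀ {n} l (l<n : l < n) f {j} → j ≤ l → label (vertex l l<n f) j ≡ f j
label-vertex {suc n} l l<1+n f j≤l with l ≟ n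
... | yes refl = bit-encode (suc n) f (s≤s j≤l)
... | no l≢n   = label-vertex l (≤∧≢⇒< (s≤s⁻¹ l<1+n) l≢n) f j≤l

-- Position l + 1 of the label of a vertex above level l records its adjacency to
-- level l; every other position reads false, so at most one disjunct can be true.
link : ∀ {n} → Vertex n → Vertex n → Bool
link x y = label y (suc (level x)) ∨ label x (suc (level y))

link-sym : ∀ {n} (x y : Vertex n) → link x y ≡ link y x
link-sym x y = ∨-comm (label y (suc (level x))) (label x (suc (level y)))

link-< : ∀ {n} (x y : Vertex n) → level x < level y → link x y ≡ label y (suc (level x))
link-< x y lt =
  trans (cong (label y (suc (level x)) ∨_) (label-beyond x (m<n⇒m<1+n lt))) (∨-identityʳ _)

link-≡ : ∀ {n} (x y : Vertex n) → level x ≡ level y → link x y ≡ false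
link-≡ x y eq =
  cong₂ _∨_ (label-beyond y (s≤s (≤-reflexive (sym eq)))) (label-beyond x (s≤s (≤-reflexive eq)))

count : ∀ n → 2 ^ suc (suc n) ∸ 2 ≡ (2 ^ suc n ∸ 2) + 2 ^ suc n
count n = begin
  2 ^ suc n + (2 ^ suc n + 0) ∸ 2 ≡⟨ cong (λ t → 2 ^ suc n + t ∸ 2) (+-identityʳ (2 ^ suc n)) ⟩
  2 ^ suc n + 2 ^ suc n ∸ 2       ≡⟨ +-∸-comm (2 ^ suc n) (^-monoʳ-≤ 2 {1} {suc n} (s≤s z≤n)) ⟩
  (2 ^ suc n ∸ 2) + 2 ^ suc n     ∎
  where open ≡-Reasoning

Fin↔Vertex : ∀ n → Fin (2 ^ suc n ∸ 2) ↔ Vertex n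
Fin↔Vertex zero    = 0↔⊥
Fin↔Vertex (suc n) = subst (λ N → Fin N ↔ Vertex (suc n)) (sym (count n))
  (↔-trans +↔⊎ (Fin↔Vertex n ⊎-↔ ↔-refl))

Universal : ∀ n → Graph (2 ^ suc n ∸ 2)
Universal n = record
  { adj    = λ u v → link (toVertex u) (toVertex v)
  ; sym    = λ u v → link-sym (toVertex u) (toVertex v)
  ; irrefl = λ u → link-≡ (toVertex u) (toVertex u) refl
  }
  where open Inverse (Fin↔Vertex n) renaming (to to toVertex)

Universal-¬HasClique : ∀ n → ¬ HasClique (suc n) (Universal n)
Universal-¬HasClique n = colourable⇒¬HasClique (Universal n) colour proper
  where
  open Inverse (Fin↔Vertex n) renaming (to to toVertex)

  colour : Fin (2 ^ suc n ∸ 2) → Fin n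
  colour u = fromℕ< (level< (toVertex u))

  proper : ∀ u v → colour u ≡ colour v → link (toVertex u) (toVertex v) ≡ false
  proper u v eq =
    link-≡ (toVertex u) (toVertex v) (fromℕ<-injective _ _ (level< (toVertex u)) (level< (toVertex v)) eq)

link-embedding⇒InducedSub : ∀ {k n} {G : Graph k} (f : Fin k → Vertex n) →
  Injective _≡_ _≡_ f → (∀ a b → link (f a) (f b) ≡ adj G a b) → InducedSub G (Universal n)
link-embedding⇒InducedSub {n = n} f f-injective f-link =
  from ∘ f ,
  (λ eq → f-injective (trans (sym (strictlyInverseˡ _)) (trans (cong to eq) (strictlyInverseˡ _)))) ,
  (λ a b → trans (cong₂ link (strictlyInverseˡ (f a)) (strictlyInverseˡ (f b))) (f-link a b))
  where open Inverse (Fin↔Vertex n)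

record Stratification {k} (G : Graph k) (n : ℕ) : Set where
  field
    layer       : Fin k → ℕ
    layer<      : ∀ a → layer a < n
    tag         : Fin k → Bool
    rep         : ℕ → Fin k
    rep-layer   : ∀ {a b} → layer a < layer b → rep (layer a) ≡ a
    independent : ∀ {a b} → layer a ≡ layer b → adj G a b ≡ false
    separated   : ∀ {a b} → layer a ≡ layer b → tag a ≡ tag b → a ≡ b

module _ {k n} {G : Graph k} (S : Stratification G n) where
  open Stratification S

  profile : Fin k → ℕ → Bool
  profile a zero    = tag a
  profile a (suc j) = adj G a (rep j)

  code : Fin k → Vertex n
  code a = vertex (layer a) (layer< a) (profile a)

  level-code : ∀ a → level (code a) ≡ layer a
  level-code a = level-vertex (layer a) (layer< a) (profile a)

  link-code-< : ∀ {a b} → layer a < layer b → link (code a) (code b) ≡ adj G a b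
  link-code-< {a} {b} lt = begin
    link (code a) (code b)
      ≡⟨ link-< (code a) (code b) (subst₂ _<_ (sym (level-code a)) (sym (level-code b)) lt) ⟩
    label (code b) (suc (level (code a)))
      ≡⟨ cong (label (code b) ∘ suc) (level-code a) ⟩
    label (code b) (suc (layer a))
      ≡⟨ label-vertex (layer b) (layer< b) (profile b) lt ⟩
    adj G b (rep (layer a))
      ≡⟨ cong (adj G b) (rep-layer lt) ⟩
    adj G b a
      ≡⟨ Graph.sym G b a ⟩
    adj G a b ∎
    where open ≡-Reasoning

  link-code : ∀ a b → link (code a) (code b) ≡ adj G a b
  link-code a b with <-cmp (layer a) (layer b)
  ... | tri< lt _ _ = link-code-< lt
  ... | tri≈ _ eq _ =
    trans (link-≡ (code a) (code b) (trans (level-code a) (trans eq (sym (level-code b)))))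
          (sym (independent eq))
  ... | tri> _ _ gt = trans (link-sym (code a) (code b)) (trans (link-code-< gt) (Graph.sym G b a))

  code-injective : Injective _≡_ _≡_ code
  code-injective {a} {b} eq = separated
    (trans (sym (level-code a)) (trans (cong level eq) (level-code b)))
    (trans (sym (label-vertex (layer a) (layer< a) (profile a) z≤n))
      (trans (cong (λ x → label x 0) eq) (label-vertex (layer b) (layer< b) (profile b) z≤n)))

  Stratification⇒InducedSub : InducedSub G (Universal n)
  Stratification⇒InducedSub = link-embedding⇒InducedSub {G = G} code code-injective link-code

nonAdjacentPair : ∀ {k} (G : Graph k) → ¬ IsComplete G → ∃₂ λ u v → u ≢ v × adj G u v ≡ false
nonAdjacentPair {k} G incomplete
  with ¬∀⟶∃¬ k _ (λ u → all? (λ v → ¬? (u ≟ᶠ v) →-dec (adj G u v ≟ᵇ true))) incomplete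
... | u , ¬complete-at-u with ¬∀⟶∃¬ k _ (λ v → ¬? (u ≟ᶠ v) →-dec (adj G u v ≟ᵇ true)) ¬complete-at-u
... | v , ¬edge =
  u , v , (λ u≡v → ¬edge (λ u≢v → ⊥-elim (u≢v u≡v))) , ¬-not (λ edge → ¬edge (λ _ → edge))

module _ {m} (G : Graph (suc (suc m))) {u v} (u≢v : u ≢ v) (u≁v : adj G u v ≡ false) where

  other : Fin m → Fin (suc (suc m))
  other = punchIn u ∘ punchIn (punchOut u≢v)

  data Position : Fin (suc (suc m)) → Set where
    at-u     : Position u
    at-v     : Position v
    at-other : ∀ q → Position (other q)

  position : ∀ w → Position w
  position w with w ≟ᶠ u
  ... | yes refl = at-u
  ... | no w≢u with w ≟ᶠ v
  ... | yes refl = at-v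
  ... | no w≢v = subst Position other-q≡w (at-other q)
    where
    u≢w : u ≢ w
    u≢w = w≢u ∘ sym

    q : Fin m
    q = punchOut {i = punchOut u≢v} {j = punchOut u≢w} (w≢v ∘ sym ∘ punchOut-injective u≢v u≢w)

    other-q≡w : other q ≡ w
    other-q≡w = trans (cong (punchIn u) (punchIn-punchOut _)) (punchIn-punchOut u≢w)

  layer : Fin (suc (suc m)) → ℕ
  layer w with position w
  ... | at-other q = toℕ q
  ... | _          = m

  layer< : ∀ w → layer w < suc m
  layer< w with position w
  ... | at-u       = n<1+n m
  ... | at-v       = n<1+n m
  ... | at-other q = m<n⇒m<1+n (toℕ<n q)

  rep : ℕ → Fin (suc (suc m))
  rep j with j <? m
  ... | yes j<m = other (fromℕ< j<m)
  ... | no _    = u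

  rep-other : ∀ q → rep (toℕ q) ≡ other q
  rep-other q with toℕ q <? m
  ... | yes q<m = cong other (fromℕ<-toℕ q q<m)
  ... | no q≮m  = ⊥-elim (q≮m (toℕ<n q))

  rep-below-top : ∀ {w} → layer w < m → rep (layer w) ≡ w
  rep-below-top {w} lt with position w
  ... | at-u       = ⊥-elim (<-irrefl refl lt)
  ... | at-v       = ⊥-elim (<-irrefl refl lt)
  ... | at-other q = rep-other q

  top : ∀ {w} → ¬ layer w < m → w ≡ u ⊎ w ≡ v
  top {w} ≮m with position w
  ... | at-u       = inj₁ refl
  ... | at-v       = inj₂ refl
  ... | at-other q = ⊥-elim (≮m (toℕ<n q))

  layer-collision : ∀ {a b} → layer a ≡ layer b → a ≢ b → (a ≡ u × b ≡ v) ⊎ (a ≡ v × b ≡ u)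
  layer-collision {a} {b} eq a≢b with layer a <? m
  ... | yes lt = ⊥-elim (a≢b (trans (sym (rep-below-top lt))
                   (trans (cong rep eq) (rep-below-top (subst (_< m) eq lt)))))
  ... | no ≮m with top ≮m | top (≮m ∘ subst (_< m) (sym eq))
  ... | inj₁ a≡u | inj₁ b≡u = ⊥-elim (a≢b (trans a≡u (sym b≡u)))
  ... | inj₁ a≡u | inj₂ b≡v = inj₁ (a≡u , b≡v)
  ... | inj₂ a≡v | inj₁ b≡u = inj₂ (a≡v , b≡u)
  ... | inj₂ a≡v | inj₂ b≡v = ⊥-elim (a≢b (trans a≡v (sym b≡v)))

  tag : Fin (suc (suc m)) → Bool
  tag w = does (w ≟ᶠ v)

  tag-u≢tag-v : tag u ≢ tag v
  tag-u≢tag-v eq with trans (sym (dec-false (u ≟ᶠ v) u≢v)) (trans eq (dec-true (v ≟ᶠ v) refl))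
  ... | ()

  independent : ∀ {a b} → layer a ≡ layer b → adj G a b ≡ false
  independent {a} {b} eq with a ≟ᶠ b
  ... | yes refl = irrefl G a
  ... | no a≢b with layer-collision eq a≢b
  ... | inj₁ (refl , refl) = u≁v
  ... | inj₂ (refl , refl) = trans (Graph.sym G v u) u≁v

  separated : ∀ {a b} → layer a ≡ layer b → tag a ≡ tag b → a ≡ b
  separated {a} {b} eq same-tag with a ≟ᶠ b
  ... | yes a≡b = a≡b
  ... | no a≢b with layer-collision eq a≢b
  ... | inj₁ (refl , refl) = ⊥-elim (tag-u≢tag-v same-tag)
  ... | inj₂ (refl , refl) = ⊥-elim (tag-u≢tag-v (sym same-tag))

  stratification : Stratification G (suc m)
  stratification = record
    { layer       = layer
    ; layer<      = layer<
    ; tag         = tag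
    ; rep         = rep
    ; rep-layer   = λ {a} {b} lt → rep-below-top (<-≤-trans lt (s≤s⁻¹ (layer< b)))
    ; independent = independent
    ; separated   = separated
    }

lemma3 : (i : ℕ) → 1 < i →
    Σ (Graph (2 ^ i ∸ 2)) λ X →
    ¬ HasClique i X ×
    ((G : Graph i) → ¬ IsComplete G → InducedSub G X)
lemma3 (suc (suc m)) (s≤s (s≤s z≤n)) =
  Universal (suc m) , Universal-¬HasClique (suc m) , embed
  where
  embed : (G : Graph (suc (suc m))) → ¬ IsComplete G → InducedSub G (Universal (suc m))
  embed G incomplete with nonAdjacentPair G incomplete
  ... | u , v , u≢v , u≁v = Stratification⇒InducedSub (stratification G u≢v u≁v)
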